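{- Let $t$ be an LSC term and $\rho : t\to_{LOU}^* u$ a derivation made of leftmost-outermost useful steps. Then there is a leftmost-outermost $\beta$-derivation $\rho\!\downarrow : t\!\downarrow \to_\beta^* u\!\downarrow$ such that $|\rho\!\downarrow| = |\rho|_{\tt dB}$.
   Context: LSC terms: $t::= x\mid \lambda x.t\mid tu\mid t[x\leftarrow u]$ ($[x\leftarrow u]$ an explicit substitution (ES) binding $x$), modulo $\alpha$. Shallow contexts $C::=\langle\cdot\rangle\mid \lambda x.C\mid Ct\mid tC\mid C[x\leftarrow t]$; general contexts additionally allow $t[x\leftarrow C]$; substitution contexts $L::=\langle\cdot\rangle\mid L[x\leftarrow t]$; applicative contexts $A::=C\langle L\, t\rangle$. LSC reduction: closure under shallow contexts of ${\tt dB}$: $(L\langle\lambda x.t\rangle)u\to L\langle t[x\leftarrow u]\rangle$ and ${\tt ls}$: $C\langle x\rangle[x\leftarrow u]\to C\langle u\rangle[x\leftarrow u]$ ($C$ not capturing $x$). An ${\tt ls}$-step $D\langle C\langle x\rangle[x\leftarrow u]\rangle\to D\langle C\langle u\rangle[x\leftarrow u]\rangle$ is written compactly $E\langle x\rangle\to E\langle u\rangle$ with $E=D\langle C[x\leftarrow u]\rangle$. Unfolding: $x\!\downarrow=x$, $(tu)\!\downarrow=t\!\downarrow u\!\downarrow$, $(\lambda x.t)\!\downarrow=\lambda x.t\!\downarrow$, $(t[x\leftarrow u])\!\downarrow=t\!\downarrow\{x\leftarrow u\!\downarrow\}$. Relative unfolding: $t\!\downarrow_{\langle\cdot\rangle}=t\!\downarrow$,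 $t\!\downarrow_{uC}=t\!\downarrow_{Cu}=t\!\downarrow_{\lambda x.C}=t\!\downarrow_C$, $t\!\downarrow_{C[x\leftarrow u]}=t\!\downarrow_C\{x\leftarrow u\!\downarrow\}$. A step is useful if it is a ${\tt dB}$-step, or an ${\tt ls}$-step $C\langle x\rangle\to C\langle r\rangle$ (compact form) such that $r\!\downarrow_C$ contains a $\beta$-redex, or $r\!\downarrow_C$ is an abstraction and $C$ is an applicative context. Position of a redex: for a ${\tt dB}$-redex $C\langle L\langle \lambda x.t\rangle u\rangle$ (and likewise a $\beta$-redex) it is $C$; for an ${\tt ls}$-redex in compact form $C\langle x\rangle\to C\langle u\rangle$ it is $C$. Write $C\prec_p t$ if $t=C\langle u\rangle$ for some $u$. Outside-in order: $\langle\cdot\rangle\prec_O C$ for all $C\neq\langle\cdot\rangle$, and $C\prec_O D$ implies $E\langle C\rangle\prec_O E\langle D\rangle$. Left-to-right order: if $C\prec_p t$ and $D\prec_p u$ then $Cu\prec_L tD$ and $C[x\leftarrow u]\prec_L t[x\leftarrow D]$, closed under $C\prec_L D\Rightarrow E\langle C\rangle\prec_L E\langle D\rangle$. $C\prec_{LO}D$ iff $C\prec_O D$ or $C\prec_L D$; redexes are ordered by their positions. The LOU (leftmost-outermost useful) redex of $t$ is the useful redex $R$ with $R\prec_{LO}Q$ for every other useful redex $Q$; $\to_{LOU}$ reduces it. $|\rho|_{\tt dB}$ is the number of ${\tt dB}$-steps of $\rho$, $|\cdot|$ the length of a derivation. -}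

module Defs where

open import Data.Nat using (ℕ; zero; suc; _+_; pred; _<ᵇ_; _≡ᵇ_)
open import Data.Bool using (if_then_else_)
open import Data.Product using (Σ; _×_; _,_)
open import Data.Sum using (_⊎_)
open import Data.Unit using (⊤)
open import Relation.Binary.PropositionalEquality using (_≡_; _≢_)

-- LSC terms, de Bruijn indices (so terms are taken modulo α).
--   var i, lam t (binds index 0 in t), app t u,
--   es t u  =  t[x←u]   (the ES binds index 0 in t, not in u)

data Tm : Set where
  var : ℕ → Tm
  lam : Tm → Tm
  app : Tm → Tm → Tm
  es  : Tm → Tm → Tm

shift : ℕ → ℕ → Tm → Tm
shift c n (var i)   = var (if i <ᵇ c then i else i + n)
shift c n (lam t)   = lam (shift (suc c) n t)
shift c n (app t u) = app (shift c n t) (shift c n u)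
shift c n (es t u)  = es (shift (suc c) n t) (shift c n u)

wk : ℕ → Tm → Tm
wk = shift 0

data Λ : Set where
  pvar : ℕ → Λ
  plam : Λ → Λ
  papp : Λ → Λ → Λ

pshift : ℕ → ℕ → Λ → Λ
pshift c n (pvar i)   = pvar (if i <ᵇ c then i else i + n)
pshift c n (plam t)   = plam (pshift (suc c) n t)
pshift c n (papp t u) = papp (pshift c n t) (pshift c n u)

-- psubst k s t : capture-avoiding meta-substitution t{k ← s}
-- (index k removed; indices above k decremented; s lives in the scope of t
-- without the binder k, and is weakened by k when it moves under k binders)
psubst : ℕ → Λ → Λ → Λ
psubst k s (pvar i)   = if i <ᵇ k then pvar i
                        else (if i ≡ᵇ k then pshift 0 k s else pvar (pred i))
psubst k s (plam t)   = plam (psubst (suc k) s t)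
psubst k s (papp t u) = papp (psubst k s t) (psubst k s u)

unf : Tm → Λ
unf (var i)   = pvar i
unf (lam t)   = plam (unf t)
unf (app t u) = papp (unf t) (unf u)
unf (es t u)  = psubst 0 (unf u) (unf t)

data SCtx : Set where
  hole : SCtx
  lamC : SCtx → SCtx
  appLC : SCtx → Tm → SCtx
  appRC : Tm → SCtx → SCtx
  esLC : SCtx → Tm → SCtx

plug : SCtx → Tm → Tm
plug hole t        = t
plug (lamC C) t    = lam (plug C t)
plug (appLC C u) t = app (plug C t) u
plug (appRC u C) t = app u (plug C t)
plug (esLC C u) t  = es (plug C t) u

_∘C_ : SCtx → SCtx → SCtx
hole ∘C D      = D
lamC C ∘C D    = lamC (C ∘C D)
appLC C u ∘C D = appLC (C ∘C D) u
appRC u C ∘C D = appRC u (C ∘C D)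
esLC C u ∘C D  = esLC (C ∘C D) u

nb : SCtx → ℕ
nb hole        = 0
nb (lamC C)    = suc (nb C)
nb (appLC C _) = nb C
nb (appRC _ C) = nb C
nb (esLC C _)  = suc (nb C)

nλ : SCtx → ℕ
nλ hole        = 0
nλ (lamC C)    = suc (nλ C)
nλ (appLC C _) = nλ C
nλ (appRC _ C) = nλ C
nλ (esLC C _)  = nλ C

data SubCtx : Set where
  shole : SubCtx
  ssub  : SubCtx → Tm → SubCtx

toS : SubCtx → SCtx
toS shole      = hole
toS (ssub L t) = esLC (toS L) t

Applicative : SCtx → Set
Applicative E = Σ SCtx λ C → Σ SubCtx λ L → Σ Tm λ t → E ≡ (C ∘C appLC (toS L) t)

-- Relative unfolding  t↓_C   (result in the scope of the λ-binders of C)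

relUnf : SCtx → Tm → Λ
relUnf hole t        = unf t
relUnf (lamC C) t    = relUnf C t
relUnf (appLC C _) t = relUnf C t
relUnf (appRC _ C) t = relUnf C t
relUnf (esLC C u) t  = psubst (nλ C) (unf u) (relUnf C t)

data PCtx : Set where
  phole : PCtx
  plamC : PCtx → PCtx
  pappLC : PCtx → Λ → PCtx
  pappRC : Λ → PCtx → PCtx

pplug : PCtx → Λ → Λ
pplug phole t        = t
pplug (plamC C) t    = plam (pplug C t)
pplug (pappLC C u) t = papp (pplug C t) u
pplug (pappRC u C) t = papp u (pplug C t)

_∘P_ : PCtx → PCtx → PCtx
phole ∘P D      = D
plamC C ∘P D    = plamC (C ∘P D)
pappLC C u ∘P D = pappLC (C ∘P D) u
pappRC u C ∘P D = pappRC u (C ∘P D)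

HasBetaRedex : Λ → Set
HasBetaRedex t = Σ PCtx λ C → Σ Λ λ s → Σ Λ λ u → t ≡ pplug C (papp (plam s) u)

IsAbs : Λ → Set
IsAbs t = Σ Λ λ s → t ≡ plam s

_≺p_ : SCtx → Tm → Set
C ≺p t = Σ Tm λ u → t ≡ plug C u

data _≺O_ : SCtx → SCtx → Set where
  O-hole : ∀ {C} → C ≢ hole → hole ≺O C
  O-ctx  : ∀ E {C D} → C ≺O D → (E ∘C C) ≺O (E ∘C D)

data _≺L_ : SCtx → SCtx → Set where
  L-app : ∀ {C D t u} → C ≺p t → D ≺p u → appLC C u ≺L appRC t D
  L-ctx : ∀ E {C D} → C ≺L D → (E ∘C C) ≺L (E ∘C D)

_≺LO_ : SCtx → SCtx → Set
C ≺LO D = C ≺O D ⊎ C ≺L D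

_≺pP_ : PCtx → Λ → Set
C ≺pP t = Σ Λ λ u → t ≡ pplug C u

data _≺OP_ : PCtx → PCtx → Set where
  O-hole : ∀ {C} → C ≢ phole → phole ≺OP C
  O-ctx  : ∀ E {C D} → C ≺OP D → (E ∘P C) ≺OP (E ∘P D)

data _≺LP_ : PCtx → PCtx → Set where
  L-app : ∀ {C D t u} → C ≺pP t → D ≺pP u → pappLC C u ≺LP pappRC t D
  L-ctx : ∀ E {C D} → C ≺LP D → (E ∘P C) ≺LP (E ∘P D)

_≺LOP_ : PCtx → PCtx → Set
C ≺LOP D = C ≺OP D ⊎ C ≺LP D

data Step (t : Tm) : SCtx → Tm → Set where
  dB : (C : SCtx) (L : SubCtx) (s u : Tm) →
       t ≡ plug C (app (plug (toS L) (lam s)) u) →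
       Step t C (plug C (plug (toS L) (es s (wk (nb (toS L)) u))))
  ls : (D C : SCtx) (u : Tm) →
       t ≡ plug D (es (plug C (var (nb C))) u) →
       Step t (D ∘C esLC C u) (plug D (es (plug C (wk (suc (nb C)) u)) u))

isDB : ∀ {t C u} → Step t C u → ℕ
isDB (dB _ _ _ _ _) = 1
isDB (ls _ _ _ _)   = 0

Useful : ∀ {t C t'} → Step t C t' → Set
Useful (dB _ _ _ _ _) = ⊤
Useful (ls D C u _) =
  HasBetaRedex (relUnf (D ∘C esLC C u) (wk (suc (nb C)) u))
  ⊎ (IsAbs (relUnf (D ∘C esLC C u) (wk (suc (nb C)) u)) × Applicative (D ∘C esLC C u))

record LOUStep (t t' : Tm) : Set where
  field
    pos      : SCtx
    step     : Step t pos t'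
    useful   : Useful step
    lo       : ∀ {D t''} (q : Step t D t'') → Useful q → D ≢ pos → pos ≺LO D

data LOU* : Tm → Tm → Set where
  []  : ∀ {t} → LOU* t t
  _∷_ : ∀ {t t' u} → LOUStep t t' → LOU* t' u → LOU* t u

dBlen : ∀ {t u} → LOU* t u → ℕ
dBlen []      = 0
dBlen (r ∷ ρ) = isDB (LOUStep.step r) + dBlen ρ

data BetaStep (t : Λ) : PCtx → Λ → Set where
  β : (C : PCtx) (s u : Λ) → t ≡ pplug C (papp (plam s) u) →
      BetaStep t C (pplug C (psubst 0 u s))

record LOβStep (t t' : Λ) : Set where
  field
    pos  : PCtx
    step : BetaStep t pos t'
    lo   : ∀ {D t''} → BetaStep t D t'' → D ≢ pos → pos ≺LOP D

data LOβ* : Λ → Λ → Set where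
  []  : ∀ {t} → LOβ* t t
  _∷_ : ∀ {t t' u} → LOβStep t t' → LOβ* t' u → LOβ* t u

βlen : ∀ {t u} → LOβ* t u → ℕ
βlen []      = 0
βlen (_ ∷ ρ) = suc (βlen ρ)

-- An ls-step leaves the unfolding unchanged, and a dB-step at position C
-- unfolds to a β-step at the unfolded position C↓.  That β-step is
-- leftmost-outermost because every β-redex of t↓ is the image of a useful
-- redex of t: a dB-redex, an ls-step whose substituted term unfolds to
-- something containing a β-redex, or an ls-step substituting an abstraction
-- into an applicative position.  Unfolding of positions is monotone for the
-- outside-in and the left-to-right order, so the image of the LOU redex lies
-- outside or to the left of every other β-redex of t↓.
module Submission where

open import Defs
open import Data.Product using (Σ; _×_; _,_)
open import Relation.Binary.PropositionalEquality
open import Function using (_∘′_)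
open import Data.Nat using (ℕ; zero; suc; _+_; pred; _<ᵇ_; _≡ᵇ_; _<_; _≤_; z≤n; s≤s; _<?_)
open import Data.Nat.Properties
open import Algebra.Properties.CommutativeSemigroup +-commutativeSemigroup using (xy∙z≈xz∙y)
open import Data.Bool using (true; false)
open import Data.Unit using (tt)
open import Data.Sum using (_⊎_; inj₁; inj₂)
open import Data.Empty using (⊥; ⊥-elim)
open import Relation.Nullary using (yes; no)
open import Relation.Binary.Definitions using (tri<; tri≈; tri>)
open ≡-Reasoning

-- De Bruijn arithmetic on pure terms

<ᵇ-true : ∀ {i c} → i < c → (i <ᵇ c) ≡ true
<ᵇ-true {zero}  {suc c} _       = refl
<ᵇ-true {suc i} {suc c} (s≤s p) = <ᵇ-true p

<ᵇ-false : ∀ {i c} → c ≤ i → (i <ᵇ c) ≡ false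
<ᵇ-false {i}     {zero}  _       = refl
<ᵇ-false {suc i} {suc c} (s≤s p) = <ᵇ-false p

≡ᵇ-refl : ∀ i → (i ≡ᵇ i) ≡ true
≡ᵇ-refl zero    = refl
≡ᵇ-refl (suc i) = ≡ᵇ-refl i

≡ᵇ-false : ∀ {i k} → i ≢ k → (i ≡ᵇ k) ≡ false
≡ᵇ-false {zero}  {zero}  p = ⊥-elim (p refl)
≡ᵇ-false {zero}  {suc k} _ = refl
≡ᵇ-false {suc i} {zero}  _ = refl
≡ᵇ-false {suc i} {suc k} p = ≡ᵇ-false (λ e → p (cong suc e))

module _ {k : ℕ} {s : Λ} where
  psubst-var-< : ∀ {i} → i < k → psubst k s (pvar i) ≡ pvar i
  psubst-var-< p rewrite <ᵇ-true p = refl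

  psubst-var-≡ : psubst k s (pvar k) ≡ pshift 0 k s
  psubst-var-≡ rewrite <ᵇ-false (≤-refl {k}) | ≡ᵇ-refl k = refl

  psubst-var-> : ∀ {i} → k < i → psubst k s (pvar i) ≡ pvar (pred i)
  psubst-var-> {i} p rewrite <ᵇ-false (<⇒≤ p) | ≡ᵇ-false {i} {k} (λ e → <-irrefl (sym e) p) = refl

module _ {c n : ℕ} where
  pshift-var-< : ∀ {i} → i < c → pshift c n (pvar i) ≡ pvar i
  pshift-var-< p rewrite <ᵇ-true p = refl

  pshift-var-≥ : ∀ {i} → c ≤ i → pshift c n (pvar i) ≡ pvar (i + n)
  pshift-var-≥ p rewrite <ᵇ-false p = refl

pshift-identity : ∀ c t → pshift c 0 t ≡ t
pshift-identity c (pvar i) with i <? c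
... | yes i<c = pshift-var-< i<c
... | no  i≮c = trans (pshift-var-≥ (≮⇒≥ i≮c)) (cong pvar (+-identityʳ i))
pshift-identity c (plam t)   = cong plam (pshift-identity (suc c) t)
pshift-identity c (papp t u) = cong₂ papp (pshift-identity c t) (pshift-identity c u)

pshift-pshift-merge : ∀ c d k m t → c ≤ d → d ≤ c + k →
                      pshift d m (pshift c k t) ≡ pshift c (k + m) t
pshift-pshift-merge c d k m (pvar i) c≤d d≤c+k with i <? c
... | yes i<c = begin
  pshift d m (pshift c k (pvar i)) ≡⟨ cong (pshift d m) (pshift-var-< i<c) ⟩
  pshift d m (pvar i)              ≡⟨ pshift-var-< (<-≤-trans i<c c≤d) ⟩
  pvar i                           ≡⟨ pshift-var-< i<c ⟨
  pshift c (k + m) (pvar i)        ∎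
... | no i≮c = begin
  pshift d m (pshift c k (pvar i)) ≡⟨ cong (pshift d m) (pshift-var-≥ (≮⇒≥ i≮c)) ⟩
  pshift d m (pvar (i + k))        ≡⟨ pshift-var-≥ (≤-trans d≤c+k (+-monoˡ-≤ k (≮⇒≥ i≮c))) ⟩
  pvar (i + k + m)                 ≡⟨ cong pvar (+-assoc i k m) ⟩
  pvar (i + (k + m))               ≡⟨ pshift-var-≥ (≮⇒≥ i≮c) ⟨
  pshift c (k + m) (pvar i)        ∎
pshift-pshift-merge c d k m (plam t) c≤d d≤c+k =
  cong plam (pshift-pshift-merge (suc c) (suc d) k m t (s≤s c≤d) (s≤s d≤c+k))
pshift-pshift-merge c d k m (papp t u) c≤d d≤c+k =
  cong₂ papp (pshift-pshift-merge c d k m t c≤d d≤c+k) (pshift-pshift-merge c d k m u c≤d d≤c+k)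

psubst-pshift-cancel : ∀ c j n s t → c ≤ j → j ≤ c + n →
                       psubst j s (pshift c (suc n) t) ≡ pshift c n t
psubst-pshift-cancel c j n s (pvar i) c≤j j≤c+n with i <? c
... | yes i<c = begin
  psubst j s (pshift c (suc n) (pvar i)) ≡⟨ cong (psubst j s) (pshift-var-< i<c) ⟩
  psubst j s (pvar i)                    ≡⟨ psubst-var-< (<-≤-trans i<c c≤j) ⟩
  pvar i                                 ≡⟨ pshift-var-< i<c ⟨
  pshift c n (pvar i)                    ∎
... | no i≮c = begin
  psubst j s (pshift c (suc n) (pvar i)) ≡⟨ cong (psubst j s) (pshift-var-≥ (≮⇒≥ i≮c)) ⟩
  psubst j s (pvar (i + suc n))          ≡⟨ cong (psubst j s ∘′ pvar) (+-suc i n) ⟩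
  psubst j s (pvar (suc (i + n)))        ≡⟨ psubst-var-> (≤-<-trans j≤c+n (s≤s (+-monoˡ-≤ n (≮⇒≥ i≮c)))) ⟩
  pvar (i + n)                           ≡⟨ pshift-var-≥ (≮⇒≥ i≮c) ⟨
  pshift c n (pvar i)                    ∎
psubst-pshift-cancel c j n s (plam t) c≤j j≤c+n =
  cong plam (psubst-pshift-cancel (suc c) (suc j) n s t (s≤s c≤j) (s≤s j≤c+n))
psubst-pshift-cancel c j n s (papp t u) c≤j j≤c+n =
  cong₂ papp (psubst-pshift-cancel c j n s t c≤j j≤c+n) (psubst-pshift-cancel c j n s u c≤j j≤c+n)

pshift-pshift-comm : ∀ d c k n s → d ≤ c →
                     pshift (c + k) n (pshift d k s) ≡ pshift d k (pshift c n s)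
pshift-pshift-comm d c k n (pvar i) d≤c with i <? d | i <? c
... | yes i<d | _ = begin
  pshift (c + k) n (pshift d k (pvar i)) ≡⟨ cong (pshift (c + k) n) (pshift-var-< i<d) ⟩
  pshift (c + k) n (pvar i)              ≡⟨ pshift-var-< (<-≤-trans i<d (≤-trans d≤c (m≤m+n c k))) ⟩
  pvar i                                 ≡⟨ pshift-var-< i<d ⟨
  pshift d k (pvar i)                    ≡⟨ cong (pshift d k) (pshift-var-< (<-≤-trans i<d d≤c)) ⟨
  pshift d k (pshift c n (pvar i))       ∎
... | no i≮d | yes i<c = begin
  pshift (c + k) n (pshift d k (pvar i)) ≡⟨ cong (pshift (c + k) n) (pshift-var-≥ (≮⇒≥ i≮d)) ⟩
  pshift (c + k) n (pvar (i + k))        ≡⟨ pshift-var-< (+-monoˡ-< k i<c) ⟩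
  pvar (i + k)                           ≡⟨ pshift-var-≥ (≮⇒≥ i≮d) ⟨
  pshift d k (pvar i)                    ≡⟨ cong (pshift d k) (pshift-var-< i<c) ⟨
  pshift d k (pshift c n (pvar i))       ∎
... | no i≮d | no i≮c = begin
  pshift (c + k) n (pshift d k (pvar i)) ≡⟨ cong (pshift (c + k) n) (pshift-var-≥ (≮⇒≥ i≮d)) ⟩
  pshift (c + k) n (pvar (i + k))        ≡⟨ pshift-var-≥ (+-monoˡ-≤ k (≮⇒≥ i≮c)) ⟩
  pvar (i + k + n)                       ≡⟨ cong pvar (xy∙z≈xz∙y i k n) ⟩
  pvar (i + n + k)                       ≡⟨ pshift-var-≥ (≤-trans (≮⇒≥ i≮d) (m≤m+n i n)) ⟨
  pshift d k (pvar (i + n))              ≡⟨ cong (pshift d k) (pshift-var-≥ (≮⇒≥ i≮c)) ⟨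
  pshift d k (pshift c n (pvar i))       ∎
pshift-pshift-comm d c k n (plam s) d≤c = cong plam (pshift-pshift-comm (suc d) (suc c) k n s (s≤s d≤c))
pshift-pshift-comm d c k n (papp s u) d≤c =
  cong₂ papp (pshift-pshift-comm d c k n s d≤c) (pshift-pshift-comm d c k n u d≤c)

pshift-psubst-comm : ∀ k c n s t →
  pshift (k + c) n (psubst k s t) ≡ psubst k (pshift c n s) (pshift (suc (k + c)) n t)
pshift-psubst-comm k c n s (pvar i) with <-cmp i k
... | tri< i<k _ _ = begin
  pshift (k + c) n (psubst k s (pvar i))           ≡⟨ cong (pshift (k + c) n) (psubst-var-< i<k) ⟩
  pshift (k + c) n (pvar i)                        ≡⟨ pshift-var-< (<-≤-trans i<k (m≤m+n k c)) ⟩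
  pvar i                                           ≡⟨ psubst-var-< i<k ⟨
  psubst k s′ (pvar i)                             ≡⟨ cong (psubst k s′) (pshift-var-< (m<n⇒m<1+n (<-≤-trans i<k (m≤m+n k c)))) ⟨
  psubst k s′ (pshift (suc (k + c)) n (pvar i))    ∎
  where s′ = pshift c n s
... | tri≈ _ refl _ = begin
  pshift (i + c) n (psubst i s (pvar i))           ≡⟨ cong (pshift (i + c) n) psubst-var-≡ ⟩
  pshift (i + c) n (pshift 0 i s)                  ≡⟨ cong (λ z → pshift z n (pshift 0 i s)) (+-comm i c) ⟩
  pshift (c + i) n (pshift 0 i s)                  ≡⟨ pshift-pshift-comm 0 c i n s z≤n ⟩
  pshift 0 i s′                                    ≡⟨ psubst-var-≡ ⟨
  psubst i s′ (pvar i)                             ≡⟨ cong (psubst i s′) (pshift-var-< (s≤s (m≤m+n i c))) ⟨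
  psubst i s′ (pshift (suc (i + c)) n (pvar i))    ∎
  where s′ = pshift c n s
pshift-psubst-comm k c n s (pvar (suc j)) | tri> _ _ k<1+j with j <? k + c
... | yes j<k+c = begin
  pshift (k + c) n (psubst k s (pvar (suc j)))        ≡⟨ cong (pshift (k + c) n) (psubst-var-> k<1+j) ⟩
  pshift (k + c) n (pvar j)                           ≡⟨ pshift-var-< j<k+c ⟩
  pvar j                                              ≡⟨ psubst-var-> k<1+j ⟨
  psubst k s′ (pvar (suc j))                          ≡⟨ cong (psubst k s′) (pshift-var-< (s≤s j<k+c)) ⟨
  psubst k s′ (pshift (suc (k + c)) n (pvar (suc j))) ∎
  where s′ = pshift c n s
... | no j≮k+c = begin
  pshift (k + c) n (psubst k s (pvar (suc j)))        ≡⟨ cong (pshift (k + c) n) (psubst-var-> k<1+j) ⟩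
  pshift (k + c) n (pvar j)                           ≡⟨ pshift-var-≥ (≮⇒≥ j≮k+c) ⟩
  pvar (j + n)                                        ≡⟨ psubst-var-> (≤-trans k<1+j (s≤s (m≤m+n j n))) ⟨
  psubst k s′ (pvar (suc j + n))                      ≡⟨ cong (psubst k s′) (pshift-var-≥ (s≤s (≮⇒≥ j≮k+c))) ⟨
  psubst k s′ (pshift (suc (k + c)) n (pvar (suc j))) ∎
  where s′ = pshift c n s
pshift-psubst-comm k c n s (plam t)   = cong plam (pshift-psubst-comm (suc k) c n s t)
pshift-psubst-comm k c n s (papp t u) = cong₂ papp (pshift-psubst-comm k c n s t) (pshift-psubst-comm k c n s u)

unf-shift : ∀ c n t → unf (shift c n t) ≡ pshift c n (unf t)
unf-shift c n (var i)   = refl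
unf-shift c n (lam t)   = cong plam (unf-shift (suc c) n t)
unf-shift c n (app t u) = cong₂ papp (unf-shift c n t) (unf-shift c n u)
unf-shift c n (es t u) rewrite unf-shift (suc c) n t | unf-shift c n u =
  sym (pshift-psubst-comm 0 c n (unf u) (unf t))

psubst-pshift-comm : ∀ c n m S A →
  psubst (c + (n + m)) S (pshift c m A) ≡ pshift c m (psubst (c + n) S A)
psubst-pshift-comm c n m S (pvar i) with i <? c
... | yes i<c = begin
  psubst (c + (n + m)) S (pshift c m (pvar i)) ≡⟨ cong (psubst (c + (n + m)) S) (pshift-var-< i<c) ⟩
  psubst (c + (n + m)) S (pvar i)              ≡⟨ psubst-var-< (<-≤-trans i<c (m≤m+n c _)) ⟩
  pvar i                                       ≡⟨ pshift-var-< i<c ⟨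
  pshift c m (pvar i)                          ≡⟨ cong (pshift c m) (psubst-var-< (<-≤-trans i<c (m≤m+n c _))) ⟨
  pshift c m (psubst (c + n) S (pvar i))       ∎
... | no i≮c with <-cmp i (c + n)
...   | tri< i<c+n _ _ = begin
  psubst (c + (n + m)) S (pshift c m (pvar i)) ≡⟨ cong (psubst (c + (n + m)) S) (pshift-var-≥ (≮⇒≥ i≮c)) ⟩
  psubst (c + (n + m)) S (pvar (i + m))        ≡⟨ psubst-var-< (subst (i + m <_) (+-assoc c n m) (+-monoˡ-< m i<c+n)) ⟩
  pvar (i + m)                                 ≡⟨ pshift-var-≥ (≮⇒≥ i≮c) ⟨
  pshift c m (pvar i)                          ≡⟨ cong (pshift c m) (psubst-var-< i<c+n) ⟨
  pshift c m (psubst (c + n) S (pvar i))       ∎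
...   | tri≈ _ refl _ = begin
  psubst (c + (n + m)) S (pshift c m (pvar (c + n)))  ≡⟨ cong (psubst (c + (n + m)) S) (pshift-var-≥ (≮⇒≥ i≮c)) ⟩
  psubst (c + (n + m)) S (pvar (c + n + m))           ≡⟨ cong (psubst (c + (n + m)) S ∘′ pvar) (+-assoc c n m) ⟩
  psubst (c + (n + m)) S (pvar (c + (n + m)))         ≡⟨ psubst-var-≡ ⟩
  pshift 0 (c + (n + m)) S                            ≡⟨ cong (λ z → pshift 0 z S) (+-assoc c n m) ⟨
  pshift 0 (c + n + m) S                              ≡⟨ pshift-pshift-merge 0 c (c + n) m S z≤n (m≤m+n c n) ⟨
  pshift c m (pshift 0 (c + n) S)                     ≡⟨ cong (pshift c m) psubst-var-≡ ⟨
  pshift c m (psubst (c + n) S (pvar (c + n)))        ∎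
psubst-pshift-comm c n m S (pvar (suc j)) | no i≮c | tri> _ _ c+n<1+j = begin
  psubst (c + (n + m)) S (pshift c m (pvar (suc j))) ≡⟨ cong (psubst (c + (n + m)) S) (pshift-var-≥ (≮⇒≥ i≮c)) ⟩
  psubst (c + (n + m)) S (pvar (suc j + m))          ≡⟨ psubst-var-> (subst (_< suc j + m) (+-assoc c n m) (+-monoˡ-< m c+n<1+j)) ⟩
  pvar (j + m)                                       ≡⟨ pshift-var-≥ (≤-trans (m≤m+n c n) (≤-pred c+n<1+j)) ⟨
  pshift c m (pvar j)                                ≡⟨ cong (pshift c m) (psubst-var-> c+n<1+j) ⟨
  pshift c m (psubst (c + n) S (pvar (suc j)))       ∎
psubst-pshift-comm c n m S (plam A)   = cong plam (psubst-pshift-comm (suc c) n m S A)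
psubst-pshift-comm c n m S (papp A B) = cong₂ papp (psubst-pshift-comm c n m S A) (psubst-pshift-comm c n m S B)

psubst-psubst : ∀ m n S A B →
  psubst (m + n) S (psubst m A B) ≡ psubst m (psubst n S A) (psubst (suc (m + n)) S B)
psubst-psubst m n S A (pvar i) with <-cmp i m
... | tri< i<m _ _ = begin
  psubst (m + n) S (psubst m A (pvar i))          ≡⟨ cong (psubst (m + n) S) (psubst-var-< i<m) ⟩
  psubst (m + n) S (pvar i)                       ≡⟨ psubst-var-< (<-≤-trans i<m (m≤m+n m n)) ⟩
  pvar i                                          ≡⟨ psubst-var-< i<m ⟨
  psubst m A′ (pvar i)                            ≡⟨ cong (psubst m A′) (psubst-var-< (m<n⇒m<1+n (<-≤-trans i<m (m≤m+n m n)))) ⟨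
  psubst m A′ (psubst (suc (m + n)) S (pvar i))   ∎
  where A′ = psubst n S A
... | tri≈ _ refl _ = begin
  psubst (i + n) S (psubst i A (pvar i))          ≡⟨ cong (psubst (i + n) S) (psubst-var-≡ {i} {A}) ⟩
  psubst (i + n) S (pshift 0 i A)                 ≡⟨ cong (λ z → psubst z S (pshift 0 i A)) (+-comm i n) ⟩
  psubst (n + i) S (pshift 0 i A)                 ≡⟨ psubst-pshift-comm 0 n i S A ⟩
  pshift 0 i A′                                   ≡⟨ psubst-var-≡ ⟨
  psubst i A′ (pvar i)                            ≡⟨ cong (psubst i A′) (psubst-var-< (s≤s (m≤m+n i n))) ⟨
  psubst i A′ (psubst (suc (i + n)) S (pvar i))   ∎
  where A′ = psubst n S A
psubst-psubst m n S A (pvar (suc j)) | tri> _ _ m<1+j with <-cmp j (m + n)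
... | tri< j<m+n _ _ = begin
  psubst (m + n) S (psubst m A (pvar (suc j)))        ≡⟨ cong (psubst (m + n) S) (psubst-var-> m<1+j) ⟩
  psubst (m + n) S (pvar j)                           ≡⟨ psubst-var-< j<m+n ⟩
  pvar j                                              ≡⟨ psubst-var-> m<1+j ⟨
  psubst m A′ (pvar (suc j))                          ≡⟨ cong (psubst m A′) (psubst-var-< (s≤s j<m+n)) ⟨
  psubst m A′ (psubst (suc (m + n)) S (pvar (suc j))) ∎
  where A′ = psubst n S A
... | tri≈ _ refl _ = begin
  psubst (m + n) S (psubst m A (pvar (suc (m + n))))  ≡⟨ cong (psubst (m + n) S) (psubst-var-> m<1+j) ⟩
  psubst (m + n) S (pvar (m + n))                     ≡⟨ psubst-var-≡ ⟩
  pshift 0 (m + n) S                                  ≡⟨ psubst-pshift-cancel 0 m (m + n) A′ S z≤n (m≤m+n m n) ⟨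
  psubst m A′ (pshift 0 (suc (m + n)) S)              ≡⟨ cong (psubst m A′) (psubst-var-≡ {suc (m + n)} {S}) ⟨
  psubst m A′ (psubst (suc (m + n)) S (pvar (suc (m + n)))) ∎
  where A′ = psubst n S A
psubst-psubst m n S A (pvar (suc (suc l))) | tri> _ _ m<2+l | tri> _ _ m+n<1+l = begin
  psubst (m + n) S (psubst m A (pvar (suc (suc l))))        ≡⟨ cong (psubst (m + n) S) (psubst-var-> m<2+l) ⟩
  psubst (m + n) S (pvar (suc l))                           ≡⟨ psubst-var-> m+n<1+l ⟩
  pvar l                                                    ≡⟨ psubst-var-> (≤-<-trans (m≤m+n m n) m+n<1+l) ⟨
  psubst m A′ (pvar (suc l))                                ≡⟨ cong (psubst m A′) (psubst-var-> (s≤s m+n<1+l)) ⟨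
  psubst m A′ (psubst (suc (m + n)) S (pvar (suc (suc l)))) ∎
  where A′ = psubst n S A
psubst-psubst m n S A (plam B)   = cong plam (psubst-psubst (suc m) n S A B)
psubst-psubst m n S A (papp B C) = cong₂ papp (psubst-psubst m n S A B) (psubst-psubst m n S A C)

lam-injective : ∀ {a b} → lam a ≡ lam b → a ≡ b
lam-injective refl = refl

app-injectiveˡ : ∀ {a b c d} → app a b ≡ app c d → a ≡ c
app-injectiveˡ refl = refl

app-injectiveʳ : ∀ {a b c d} → app a b ≡ app c d → b ≡ d
app-injectiveʳ refl = refl

es-injectiveˡ : ∀ {a b c d} → es a b ≡ es c d → a ≡ c
es-injectiveˡ refl = refl

plam-injective : ∀ {a b} → plam a ≡ plam b → a ≡ b
plam-injective refl = refl

papp-injectiveˡ : ∀ {a b c d} → papp a b ≡ papp c d → a ≡ c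
papp-injectiveˡ refl = refl

papp-injectiveʳ : ∀ {a b c d} → papp a b ≡ papp c d → b ≡ d
papp-injectiveʳ refl = refl

plug-injective : ∀ C {a b} → plug C a ≡ plug C b → a ≡ b
plug-injective hole        e = e
plug-injective (lamC C)    e = plug-injective C (lam-injective e)
plug-injective (appLC C _) e = plug-injective C (app-injectiveˡ e)
plug-injective (appRC _ C) e = plug-injective C (app-injectiveʳ e)
plug-injective (esLC C _)  e = plug-injective C (es-injectiveˡ e)

pplug-injective : ∀ C {a b} → pplug C a ≡ pplug C b → a ≡ b
pplug-injective phole        e = e
pplug-injective (plamC C)    e = pplug-injective C (plam-injective e)
pplug-injective (pappLC C _) e = pplug-injective C (papp-injectiveˡ e)
pplug-injective (pappRC _ C) e = pplug-injective C (papp-injectiveʳ e)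

plug-∘ : ∀ C D x → plug (C ∘C D) x ≡ plug C (plug D x)
plug-∘ hole        D x = refl
plug-∘ (lamC C)    D x = cong lam (plug-∘ C D x)
plug-∘ (appLC C u) D x = cong (λ z → app z u) (plug-∘ C D x)
plug-∘ (appRC u C) D x = cong (app u) (plug-∘ C D x)
plug-∘ (esLC C u)  D x = cong (λ z → es z u) (plug-∘ C D x)

pplug-∘ : ∀ C D x → pplug (C ∘P D) x ≡ pplug C (pplug D x)
pplug-∘ phole        D x = refl
pplug-∘ (plamC C)    D x = cong plam (pplug-∘ C D x)
pplug-∘ (pappLC C u) D x = cong (λ z → papp z u) (pplug-∘ C D x)
pplug-∘ (pappRC u C) D x = cong (papp u) (pplug-∘ C D x)

∘C-assoc : ∀ A B C → (A ∘C B) ∘C C ≡ A ∘C (B ∘C C)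
∘C-assoc hole        B C = refl
∘C-assoc (lamC A)    B C = cong lamC (∘C-assoc A B C)
∘C-assoc (appLC A u) B C = cong (λ z → appLC z u) (∘C-assoc A B C)
∘C-assoc (appRC u A) B C = cong (appRC u) (∘C-assoc A B C)
∘C-assoc (esLC A u)  B C = cong (λ z → esLC z u) (∘C-assoc A B C)

∘P-assoc : ∀ A B C → (A ∘P B) ∘P C ≡ A ∘P (B ∘P C)
∘P-assoc phole        B C = refl
∘P-assoc (plamC A)    B C = cong plamC (∘P-assoc A B C)
∘P-assoc (pappLC A u) B C = cong (λ z → pappLC z u) (∘P-assoc A B C)
∘P-assoc (pappRC u A) B C = cong (pappRC u) (∘P-assoc A B C)

∘C-identityʳ : ∀ A → A ∘C hole ≡ A
∘C-identityʳ hole        = refl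
∘C-identityʳ (lamC A)    = cong lamC (∘C-identityʳ A)
∘C-identityʳ (appLC A u) = cong (λ z → appLC z u) (∘C-identityʳ A)
∘C-identityʳ (appRC u A) = cong (appRC u) (∘C-identityʳ A)
∘C-identityʳ (esLC A u)  = cong (λ z → esLC z u) (∘C-identityʳ A)

∘P-identityʳ : ∀ A → A ∘P phole ≡ A
∘P-identityʳ phole        = refl
∘P-identityʳ (plamC A)    = cong plamC (∘P-identityʳ A)
∘P-identityʳ (pappLC A u) = cong (λ z → pappLC z u) (∘P-identityʳ A)
∘P-identityʳ (pappRC u A) = cong (pappRC u) (∘P-identityʳ A)

lamC-injective : ∀ {a b} → lamC a ≡ lamC b → a ≡ b
lamC-injective refl = refl

appLC-injectiveˡ : ∀ {a b c d} → appLC a b ≡ appLC c d → a ≡ c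
appLC-injectiveˡ refl = refl

appLC-injectiveʳ : ∀ {a b c d} → appLC a b ≡ appLC c d → b ≡ d
appLC-injectiveʳ refl = refl

appRC-injectiveˡ : ∀ {a b c d} → appRC a b ≡ appRC c d → a ≡ c
appRC-injectiveˡ refl = refl

appRC-injectiveʳ : ∀ {a b c d} → appRC a b ≡ appRC c d → b ≡ d
appRC-injectiveʳ refl = refl

esLC-injectiveˡ : ∀ {a b c d} → esLC a b ≡ esLC c d → a ≡ c
esLC-injectiveˡ refl = refl

esLC-injectiveʳ : ∀ {a b c d} → esLC a b ≡ esLC c d → b ≡ d
esLC-injectiveʳ refl = refl

PrefixSplit : SCtx → SCtx → SCtx → SCtx → Set
PrefixSplit A X B Y =
  (Σ SCtx λ G → B ≡ A ∘C G × X ≡ G ∘C Y) ⊎ (Σ SCtx λ G → A ≡ B ∘C G × Y ≡ G ∘C X)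

PrefixSplit-under : ∀ {A X B Y} (F : SCtx → SCtx) → PrefixSplit A X B Y →
  (Σ SCtx λ G → F B ≡ F (A ∘C G) × X ≡ G ∘C Y) ⊎ (Σ SCtx λ G → F A ≡ F (B ∘C G) × Y ≡ G ∘C X)
PrefixSplit-under F (inj₁ (G , p , q)) = inj₁ (G , cong F p , q)
PrefixSplit-under F (inj₂ (G , p , q)) = inj₂ (G , cong F p , q)

∘C-prefixes-comparable : ∀ A X B Y → A ∘C X ≡ B ∘C Y → PrefixSplit A X B Y
∘C-prefixes-comparable hole X B Y e = inj₁ (B , refl , e)
∘C-prefixes-comparable A X hole Y e = inj₂ (A , refl , sym e)
∘C-prefixes-comparable (lamC A) X (lamC B) Y e =
  PrefixSplit-under lamC (∘C-prefixes-comparable A X B Y (lamC-injective e))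
∘C-prefixes-comparable (appLC A u) X (appLC B u′) Y e with refl ← appLC-injectiveʳ e =
  PrefixSplit-under (λ Z → appLC Z u) (∘C-prefixes-comparable A X B Y (appLC-injectiveˡ e))
∘C-prefixes-comparable (appRC u A) X (appRC u′ B) Y e with refl ← appRC-injectiveˡ e =
  PrefixSplit-under (appRC u) (∘C-prefixes-comparable A X B Y (appRC-injectiveʳ e))
∘C-prefixes-comparable (esLC A u) X (esLC B u′) Y e with refl ← esLC-injectiveʳ e =
  PrefixSplit-under (λ Z → esLC Z u) (∘C-prefixes-comparable A X B Y (esLC-injectiveˡ e))

suffix-of-toS : ∀ L G F → toS L ≡ G ∘C F → Σ SubCtx λ L′ → F ≡ toS L′
suffix-of-toS L          hole       F e = L , sym e
suffix-of-toS (ssub L u) (esLC G _) F e = suffix-of-toS L G F (esLC-injectiveˡ e)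
suffix-of-toS shole      (esLC _ _)  _ ()
suffix-of-toS shole      (lamC _)    _ ()
suffix-of-toS shole      (appLC _ _) _ ()
suffix-of-toS shole      (appRC _ _) _ ()
suffix-of-toS (ssub _ _) (lamC _)    _ ()
suffix-of-toS (ssub _ _) (appLC _ _) _ ()
suffix-of-toS (ssub _ _) (appRC _ _) _ ()

appRC≢toS : ∀ L a C → appRC a C ≢ toS L
appRC≢toS shole      a C ()
appRC≢toS (ssub L _) a C ()

plug-toS-var≢app : ∀ L i a b → plug (toS L) (var i) ≢ app a b
plug-toS-var≢app shole      i a b ()
plug-toS-var≢app (ssub L _) i a b ()

-- Unfolding of contexts

nλP : PCtx → ℕ
nλP phole        = 0
nλP (plamC C)    = suc (nλP C)
nλP (pappLC C _) = nλP C
nλP (pappRC _ C) = nλP C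

psubstCtx : ℕ → Λ → PCtx → PCtx
psubstCtx k s phole        = phole
psubstCtx k s (plamC C)    = plamC (psubstCtx (suc k) s C)
psubstCtx k s (pappLC C u) = pappLC (psubstCtx k s C) (psubst k s u)
psubstCtx k s (pappRC u C) = pappRC (psubst k s u) (psubstCtx k s C)

unfCtx : SCtx → PCtx
unfCtx hole        = phole
unfCtx (lamC C)    = plamC (unfCtx C)
unfCtx (appLC C u) = pappLC (unfCtx C) (unf u)
unfCtx (appRC u C) = pappRC (unf u) (unfCtx C)
unfCtx (esLC C u)  = psubstCtx 0 (unf u) (unfCtx C)

-- relSub C k T applies the explicit substitutions of C to a pure term T
-- lying k binders below the hole; relUnf C t is relSub C 0 (unf t).
relSub : SCtx → ℕ → Λ → Λ
relSub hole        k T = T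
relSub (lamC C)    k T = relSub C k T
relSub (appLC C _) k T = relSub C k T
relSub (appRC _ C) k T = relSub C k T
relSub (esLC C u)  k T = psubst (k + nλ C) (unf u) (relSub C k T)

relSubCtx : SCtx → ℕ → PCtx → PCtx
relSubCtx hole        k P = P
relSubCtx (lamC C)    k P = relSubCtx C k P
relSubCtx (appLC C _) k P = relSubCtx C k P
relSubCtx (appRC _ C) k P = relSubCtx C k P
relSubCtx (esLC C u)  k P = psubstCtx (k + nλ C) (unf u) (relSubCtx C k P)

relUnf-relSub : ∀ C t → relUnf C t ≡ relSub C 0 (unf t)
relUnf-relSub hole        t = refl
relUnf-relSub (lamC C)    t = relUnf-relSub C t
relUnf-relSub (appLC C _) t = relUnf-relSub C t
relUnf-relSub (appRC _ C) t = relUnf-relSub C t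
relUnf-relSub (esLC C u)  t = cong (psubst (nλ C) (unf u)) (relUnf-relSub C t)

nλP-psubstCtx : ∀ k s P → nλP (psubstCtx k s P) ≡ nλP P
nλP-psubstCtx k s phole        = refl
nλP-psubstCtx k s (plamC P)    = cong suc (nλP-psubstCtx (suc k) s P)
nλP-psubstCtx k s (pappLC P _) = nλP-psubstCtx k s P
nλP-psubstCtx k s (pappRC _ P) = nλP-psubstCtx k s P

nλP-unfCtx : ∀ C → nλP (unfCtx C) ≡ nλ C
nλP-unfCtx hole        = refl
nλP-unfCtx (lamC C)    = cong suc (nλP-unfCtx C)
nλP-unfCtx (appLC C _) = nλP-unfCtx C
nλP-unfCtx (appRC _ C) = nλP-unfCtx C
nλP-unfCtx (esLC C u)  = trans (nλP-psubstCtx 0 (unf u) (unfCtx C)) (nλP-unfCtx C)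

nλ-∘ : ∀ C D → nλ (C ∘C D) ≡ nλ C + nλ D
nλ-∘ hole        D = refl
nλ-∘ (lamC C)    D = cong suc (nλ-∘ C D)
nλ-∘ (appLC C _) D = nλ-∘ C D
nλ-∘ (appRC _ C) D = nλ-∘ C D
nλ-∘ (esLC C _)  D = nλ-∘ C D

nλ-toS : ∀ L → nλ (toS L) ≡ 0
nλ-toS shole      = refl
nλ-toS (ssub L _) = nλ-toS L

psubst-pplug : ∀ k s P y → psubst k s (pplug P y) ≡ pplug (psubstCtx k s P) (psubst (k + nλP P) s y)
psubst-pplug k s phole        y = cong (λ z → psubst z s y) (sym (+-identityʳ k))
psubst-pplug k s (plamC P)    y rewrite +-suc k (nλP P) = cong plam (psubst-pplug (suc k) s P y)
psubst-pplug k s (pappLC P u) y = cong (λ z → papp z (psubst k s u)) (psubst-pplug k s P y)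
psubst-pplug k s (pappRC u P) y = cong (papp (psubst k s u)) (psubst-pplug k s P y)

psubstCtx-∘ : ∀ k s X Y → psubstCtx k s (X ∘P Y) ≡ psubstCtx k s X ∘P psubstCtx (k + nλP X) s Y
psubstCtx-∘ k s phole        Y = cong (λ z → psubstCtx z s Y) (sym (+-identityʳ k))
psubstCtx-∘ k s (plamC X)    Y rewrite +-suc k (nλP X) = cong plamC (psubstCtx-∘ (suc k) s X Y)
psubstCtx-∘ k s (pappLC X u) Y = cong (λ z → pappLC z (psubst k s u)) (psubstCtx-∘ k s X Y)
psubstCtx-∘ k s (pappRC u X) Y = cong (pappRC (psubst k s u)) (psubstCtx-∘ k s X Y)

unf-plug : ∀ C x → unf (plug C x) ≡ pplug (unfCtx C) (relSub C 0 (unf x))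
unf-plug hole        x = refl
unf-plug (lamC C)    x = cong plam (unf-plug C x)
unf-plug (appLC C u) x = cong (λ z → papp z (unf u)) (unf-plug C x)
unf-plug (appRC u C) x = cong (papp (unf u)) (unf-plug C x)
unf-plug (esLC C u)  x = begin
  psubst 0 (unf u) (unf (plug C x))                          ≡⟨ cong (psubst 0 (unf u)) (unf-plug C x) ⟩
  psubst 0 (unf u) (pplug (unfCtx C) (relSub C 0 (unf x)))  ≡⟨ psubst-pplug 0 (unf u) (unfCtx C) _ ⟩
  pplug (unfCtx (esLC C u)) (psubst (nλP (unfCtx C)) (unf u) (relSub C 0 (unf x)))
    ≡⟨ cong (λ n → pplug (unfCtx (esLC C u)) (psubst n (unf u) (relSub C 0 (unf x)))) (nλP-unfCtx C) ⟩
  pplug (unfCtx (esLC C u)) (relSub (esLC C u) 0 (unf x))    ∎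

unf-plug-toS : ∀ L x → unf (plug (toS L) x) ≡ relSub (toS L) 0 (unf x)
unf-plug-toS shole      x = refl
unf-plug-toS (ssub L v) x rewrite nλ-toS L = cong (psubst 0 (unf v)) (unf-plug-toS L x)

relSub-papp : ∀ C k A B → relSub C k (papp A B) ≡ papp (relSub C k A) (relSub C k B)
relSub-papp hole        k A B = refl
relSub-papp (lamC C)    k A B = relSub-papp C k A B
relSub-papp (appLC C _) k A B = relSub-papp C k A B
relSub-papp (appRC _ C) k A B = relSub-papp C k A B
relSub-papp (esLC C u)  k A B = cong (psubst (k + nλ C) (unf u)) (relSub-papp C k A B)

relSub-plam : ∀ C k A → relSub C k (plam A) ≡ plam (relSub C (suc k) A)
relSub-plam hole        k A = refl
relSub-plam (lamC C)    k A = relSub-plam C k A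
relSub-plam (appLC C _) k A = relSub-plam C k A
relSub-plam (appRC _ C) k A = relSub-plam C k A
relSub-plam (esLC C u)  k A = cong (psubst (k + nλ C) (unf u)) (relSub-plam C k A)

relSub-∘ : ∀ X Y k T → relSub (X ∘C Y) k T ≡ relSub X (k + nλ Y) (relSub Y k T)
relSub-∘ hole        Y k T = refl
relSub-∘ (lamC X)    Y k T = relSub-∘ X Y k T
relSub-∘ (appLC X _) Y k T = relSub-∘ X Y k T
relSub-∘ (appRC _ X) Y k T = relSub-∘ X Y k T
relSub-∘ (esLC X u)  Y k T = cong₂ (λ n → psubst n (unf u)) depth (relSub-∘ X Y k T)
  where
    depth : k + nλ (X ∘C Y) ≡ k + nλ Y + nλ X
    depth = trans (cong (k +_) (trans (nλ-∘ X Y) (+-comm (nλ X) (nλ Y)))) (sym (+-assoc k (nλ Y) (nλ X)))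

relSub-psubst : ∀ X k A B → relSub X k (psubst k A B) ≡ psubst k (relSub X 0 A) (relSub X (suc k) B)
relSub-psubst hole        k A B = refl
relSub-psubst (lamC X)    k A B = relSub-psubst X k A B
relSub-psubst (appLC X _) k A B = relSub-psubst X k A B
relSub-psubst (appRC _ X) k A B = relSub-psubst X k A B
relSub-psubst (esLC X u)  k A B = trans (cong (psubst (k + nλ X) (unf u)) (relSub-psubst X k A B))
                                        (psubst-psubst k (nλ X) (unf u) (relSub X 0 A) (relSub X (suc k) B))

relSub-free-var : ∀ C k → relSub C 0 (pvar (k + nb C)) ≡ pvar (k + nλ C)
relSub-free-var hole        k = refl
relSub-free-var (lamC C)    k rewrite +-suc k (nb C) | +-suc k (nλ C) = relSub-free-var C (suc k)
relSub-free-var (appLC C _) k = relSub-free-var C k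
relSub-free-var (appRC _ C) k = relSub-free-var C k
relSub-free-var (esLC C u)  k rewrite +-suc k (nb C) | relSub-free-var C (suc k) =
  psubst-var-> (s≤s (m≤n+m (nλ C) k))

relSub-pshift : ∀ C k U → relSub C 0 (pshift 0 (k + nb C) U) ≡ pshift 0 (k + nλ C) U
relSub-pshift hole        k U = refl
relSub-pshift (lamC C)    k U rewrite +-suc k (nb C) | +-suc k (nλ C) = relSub-pshift C (suc k) U
relSub-pshift (appLC C _) k U = relSub-pshift C k U
relSub-pshift (appRC _ C) k U = relSub-pshift C k U
relSub-pshift (esLC C u)  k U rewrite +-suc k (nb C) | relSub-pshift C (suc k) U =
  psubst-pshift-cancel 0 (nλ C) (k + nλ C) (unf u) U z≤n (m≤n+m (nλ C) k)

relSubCtx-phole : ∀ C k → relSubCtx C k phole ≡ phole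
relSubCtx-phole hole        k = refl
relSubCtx-phole (lamC C)    k = relSubCtx-phole C k
relSubCtx-phole (appLC C _) k = relSubCtx-phole C k
relSubCtx-phole (appRC _ C) k = relSubCtx-phole C k
relSubCtx-phole (esLC C u)  k = cong (psubstCtx (k + nλ C) (unf u)) (relSubCtx-phole C k)

relSubCtx-plamC : ∀ C k X → relSubCtx C k (plamC X) ≡ plamC (relSubCtx C (suc k) X)
relSubCtx-plamC hole        k X = refl
relSubCtx-plamC (lamC C)    k X = relSubCtx-plamC C k X
relSubCtx-plamC (appLC C _) k X = relSubCtx-plamC C k X
relSubCtx-plamC (appRC _ C) k X = relSubCtx-plamC C k X
relSubCtx-plamC (esLC C u)  k X = cong (psubstCtx (k + nλ C) (unf u)) (relSubCtx-plamC C k X)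

relSubCtx-pappLC : ∀ C k X v → relSubCtx C k (pappLC X v) ≡ pappLC (relSubCtx C k X) (relSub C k v)
relSubCtx-pappLC hole        k X v = refl
relSubCtx-pappLC (lamC C)    k X v = relSubCtx-pappLC C k X v
relSubCtx-pappLC (appLC C _) k X v = relSubCtx-pappLC C k X v
relSubCtx-pappLC (appRC _ C) k X v = relSubCtx-pappLC C k X v
relSubCtx-pappLC (esLC C u)  k X v = cong (psubstCtx (k + nλ C) (unf u)) (relSubCtx-pappLC C k X v)

relSubCtx-pappRC : ∀ C k X v → relSubCtx C k (pappRC v X) ≡ pappRC (relSub C k v) (relSubCtx C k X)
relSubCtx-pappRC hole        k X v = refl
relSubCtx-pappRC (lamC C)    k X v = relSubCtx-pappRC C k X v
relSubCtx-pappRC (appLC C _) k X v = relSubCtx-pappRC C k X v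
relSubCtx-pappRC (appRC _ C) k X v = relSubCtx-pappRC C k X v
relSubCtx-pappRC (esLC C u)  k X v = cong (psubstCtx (k + nλ C) (unf u)) (relSubCtx-pappRC C k X v)

unfCtx-∘ : ∀ C F → unfCtx (C ∘C F) ≡ unfCtx C ∘P relSubCtx C 0 (unfCtx F)
unfCtx-∘ hole        F = refl
unfCtx-∘ (lamC C)    F = cong plamC (unfCtx-∘ C F)
unfCtx-∘ (appLC C u) F = cong (λ z → pappLC z (unf u)) (unfCtx-∘ C F)
unfCtx-∘ (appRC u C) F = cong (pappRC (unf u)) (unfCtx-∘ C F)
unfCtx-∘ (esLC C u)  F = begin
  psubstCtx 0 (unf u) (unfCtx (C ∘C F))                       ≡⟨ cong (psubstCtx 0 (unf u)) (unfCtx-∘ C F) ⟩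
  psubstCtx 0 (unf u) (unfCtx C ∘P relSubCtx C 0 (unfCtx F))  ≡⟨ psubstCtx-∘ 0 (unf u) (unfCtx C) _ ⟩
  unfCtx (esLC C u) ∘P psubstCtx (nλP (unfCtx C)) (unf u) (relSubCtx C 0 (unfCtx F))
    ≡⟨ cong (λ n → unfCtx (esLC C u) ∘P psubstCtx n (unf u) (relSubCtx C 0 (unfCtx F))) (nλP-unfCtx C) ⟩
  unfCtx (esLC C u) ∘P relSubCtx (esLC C u) 0 (unfCtx F)       ∎

-- ls-steps are invisible, dB-steps are β-steps

relSub-ES-bound-var : ∀ D C u →
  relSub (D ∘C esLC C u) 0 (pvar (nb C)) ≡ relUnf (D ∘C esLC C u) (wk (suc (nb C)) u)
relSub-ES-bound-var D C u = begin
  relSub (D ∘C esLC C u) 0 (pvar (nb C))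
    ≡⟨ relSub-∘ D (esLC C u) 0 _ ⟩
  relSub D (nλ C) (psubst (nλ C) (unf u) (relSub C 0 (pvar (0 + nb C))))
    ≡⟨ cong (relSub D (nλ C) ∘′ psubst (nλ C) (unf u)) (relSub-free-var C 0) ⟩
  relSub D (nλ C) (psubst (nλ C) (unf u) (pvar (nλ C)))
    ≡⟨ cong (relSub D (nλ C)) psubst-var-≡ ⟩
  relSub D (nλ C) (pshift 0 (nλ C) (unf u))
    ≡⟨ cong (relSub D (nλ C)) (psubst-pshift-cancel 0 (nλ C) (nλ C) (unf u) (unf u) z≤n ≤-refl) ⟨
  relSub D (nλ C) (psubst (nλ C) (unf u) (pshift 0 (1 + nλ C) (unf u)))
    ≡⟨ cong (relSub D (nλ C) ∘′ psubst (nλ C) (unf u)) (relSub-pshift C 1 (unf u)) ⟨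
  relSub D (nλ C) (psubst (nλ C) (unf u) (relSub C 0 (pshift 0 (suc (nb C)) (unf u))))
    ≡⟨ cong (relSub D (nλ C) ∘′ psubst (nλ C) (unf u) ∘′ relSub C 0) (unf-shift 0 (suc (nb C)) u) ⟨
  relSub D (nλ C) (psubst (nλ C) (unf u) (relSub C 0 (unf (wk (suc (nb C)) u))))
    ≡⟨ relSub-∘ D (esLC C u) 0 _ ⟨
  relSub (D ∘C esLC C u) 0 (unf (wk (suc (nb C)) u))
    ≡⟨ relUnf-relSub (D ∘C esLC C u) _ ⟨
  relUnf (D ∘C esLC C u) (wk (suc (nb C)) u) ∎

ls-preserves-unf : ∀ D C u →
  unf (plug D (es (plug C (var (nb C))) u)) ≡ unf (plug D (es (plug C (wk (suc (nb C)) u)) u))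
ls-preserves-unf D C u = begin
  unf (plug D (es (plug C (var (nb C))) u))                   ≡⟨ cong unf (plug-∘ D (esLC C u) _) ⟨
  unf (plug P (var (nb C)))                                   ≡⟨ unf-plug P _ ⟩
  pplug (unfCtx P) (relSub P 0 (pvar (nb C)))                 ≡⟨ cong (pplug (unfCtx P)) (relSub-ES-bound-var D C u) ⟩
  pplug (unfCtx P) (relUnf P (wk (suc (nb C)) u))             ≡⟨ cong (pplug (unfCtx P)) (relUnf-relSub P _) ⟩
  pplug (unfCtx P) (relSub P 0 (unf (wk (suc (nb C)) u)))     ≡⟨ unf-plug P _ ⟨
  unf (plug P (wk (suc (nb C)) u))                            ≡⟨ cong unf (plug-∘ D (esLC C u) _) ⟩
  unf (plug D (es (plug C (wk (suc (nb C)) u)) u))            ∎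
  where P = D ∘C esLC C u

dBBody : SCtx → SubCtx → Tm → Λ
dBBody C L s = relSub C 1 (relSub (toS L) 1 (unf s))

unf-dB-redex : ∀ C L s u →
  unf (plug C (app (plug (toS L) (lam s)) u)) ≡ pplug (unfCtx C) (papp (plam (dBBody C L s)) (relSub C 0 (unf u)))
unf-dB-redex C L s u = begin
  unf (plug C (app (plug (toS L) (lam s)) u))
    ≡⟨ unf-plug C _ ⟩
  pplug (unfCtx C) (relSub C 0 (papp (unf (plug (toS L) (lam s))) (unf u)))
    ≡⟨ cong (pplug (unfCtx C)) (relSub-papp C 0 _ _) ⟩
  pplug (unfCtx C) (papp (relSub C 0 (unf (plug (toS L) (lam s)))) (relSub C 0 (unf u)))
    ≡⟨ cong (λ z → pplug (unfCtx C) (papp (relSub C 0 z) (relSub C 0 (unf u))))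
            (trans (unf-plug-toS L (lam s)) (relSub-plam (toS L) 0 (unf s))) ⟩
  pplug (unfCtx C) (papp (relSub C 0 (plam (relSub (toS L) 1 (unf s)))) (relSub C 0 (unf u)))
    ≡⟨ cong (λ z → pplug (unfCtx C) (papp z (relSub C 0 (unf u)))) (relSub-plam C 0 _) ⟩
  pplug (unfCtx C) (papp (plam (dBBody C L s)) (relSub C 0 (unf u))) ∎

unf-dB-contractum : ∀ C L s u →
  unf (plug C (plug (toS L) (es s (wk (nb (toS L)) u)))) ≡ pplug (unfCtx C) (psubst 0 (relSub C 0 (unf u)) (dBBody C L s))
unf-dB-contractum C L s u = begin
  unf (plug C (plug (toS L) (es s u′)))                                ≡⟨ unf-plug C _ ⟩
  pplug (unfCtx C) (relSub C 0 (unf (plug (toS L) (es s u′))))        ≡⟨ cong (pplug (unfCtx C) ∘′ relSub C 0) inner ⟩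
  pplug (unfCtx C) (relSub C 0 (psubst 0 (unf u) (relSub (toS L) 1 (unf s))))
    ≡⟨ cong (pplug (unfCtx C)) (relSub-psubst C 0 _ _) ⟩
  pplug (unfCtx C) (psubst 0 (relSub C 0 (unf u)) (dBBody C L s))     ∎
  where
    u′ = wk (nb (toS L)) u
    argument : relSub (toS L) 0 (unf u′) ≡ unf u
    argument = begin
      relSub (toS L) 0 (unf u′)                ≡⟨ cong (relSub (toS L) 0) (unf-shift 0 (nb (toS L)) u) ⟩
      relSub (toS L) 0 (pshift 0 (nb (toS L)) (unf u)) ≡⟨ relSub-pshift (toS L) 0 (unf u) ⟩
      pshift 0 (nλ (toS L)) (unf u)            ≡⟨ cong (λ n → pshift 0 n (unf u)) (nλ-toS L) ⟩
      pshift 0 0 (unf u)                       ≡⟨ pshift-identity 0 (unf u) ⟩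
      unf u                                    ∎
    inner : unf (plug (toS L) (es s u′)) ≡ psubst 0 (unf u) (relSub (toS L) 1 (unf s))
    inner = begin
      unf (plug (toS L) (es s u′))                                        ≡⟨ unf-plug-toS L _ ⟩
      relSub (toS L) 0 (psubst 0 (unf u′) (unf s))                        ≡⟨ relSub-psubst (toS L) 0 _ _ ⟩
      psubst 0 (relSub (toS L) 0 (unf u′)) (relSub (toS L) 1 (unf s))
        ≡⟨ cong (λ z → psubst 0 z (relSub (toS L) 1 (unf s))) argument ⟩
      psubst 0 (unf u) (relSub (toS L) 1 (unf s))                         ∎

-- Where the β-redexes of an unfolding come from

ESBound : SCtx → ℕ → Set
ESBound E i = Σ SCtx λ E₁ → Σ SCtx λ C → Σ Tm λ u → E ≡ E₁ ∘C esLC C u × nb C ≡ i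

-- Index i at the hole of C is bound by a λ of C, or is free with j its
-- index once the explicit substitutions of C are unfolded.
LamBoundOrFree : SCtx → ℕ → ℕ → Set
LamBoundOrFree C i j = (i < nb C × j < nλ C) ⊎ (Σ ℕ λ k → i ≡ k + nb C × j ≡ k + nλ C)

LamBoundOrFree-lamC : ∀ C i j → LamBoundOrFree C i j → LamBoundOrFree (lamC C) i j
LamBoundOrFree-lamC C i j (inj₁ (i<nb , j<nλ)) = inj₁ (m<n⇒m<1+n i<nb , m<n⇒m<1+n j<nλ)
LamBoundOrFree-lamC C i j (inj₂ (zero , refl , refl)) = inj₁ (≤-refl , ≤-refl)
LamBoundOrFree-lamC C i j (inj₂ (suc k , refl , refl)) = inj₂ (k , sym (+-suc k (nb C)) , sym (+-suc k (nλ C)))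

var-binder : ∀ E i → ESBound E i ⊎ (Σ ℕ λ j → relSub E 0 (pvar i) ≡ pvar j × LamBoundOrFree E i j)
var-binder hole i = inj₂ (i , refl , inj₂ (i , sym (+-identityʳ i) , sym (+-identityʳ i)))
var-binder (lamC C) i with var-binder C i
... | inj₁ (E₁ , C′ , u , refl , q) = inj₁ (lamC E₁ , C′ , u , refl , q)
... | inj₂ (j , e , b)             = inj₂ (j , e , LamBoundOrFree-lamC C i j b)
var-binder (appLC C t) i with var-binder C i
... | inj₁ (E₁ , C′ , u , refl , q) = inj₁ (appLC E₁ t , C′ , u , refl , q)
... | inj₂ r                       = inj₂ r
var-binder (appRC t C) i with var-binder C i
... | inj₁ (E₁ , C′ , u , refl , q) = inj₁ (appRC t E₁ , C′ , u , refl , q)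
... | inj₂ r                       = inj₂ r
var-binder (esLC C u) i with var-binder C i
... | inj₁ (E₁ , C′ , u′ , refl , q) = inj₁ (esLC E₁ u , C′ , u′ , refl , q)
... | inj₂ (j , e , inj₁ (i<nb , j<nλ)) =
  inj₂ (j , trans (cong (psubst (nλ C) (unf u)) e) (psubst-var-< j<nλ) , inj₁ (m<n⇒m<1+n i<nb , j<nλ))
... | inj₂ (j , e , inj₂ (zero , i≡nb , _)) = inj₁ (hole , C , u , refl , sym i≡nb)
... | inj₂ (j , e , inj₂ (suc k , i≡ , refl)) =
  inj₂ (k + nλ C , trans (cong (psubst (nλ C) (unf u)) e) (psubst-var-> (s≤s (m≤n+m (nλ C) k))) ,
        inj₂ (k , trans i≡ (sym (+-suc k (nb C))) , refl))

data RedexOrigin (t : Tm) (R : PCtx) : Set where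
  dB-redex : ∀ C L s u → t ≡ plug C (app (plug (toS L) (lam s)) u) → unfCtx C ≡ R → RedexOrigin t R
  ls-redex : ∀ D C u → t ≡ plug D (es (plug C (var (nb C))) u) →
             HasBetaRedex (relUnf (D ∘C esLC C u) (wk (suc (nb C)) u)) →
             ∀ P → unfCtx (D ∘C esLC C u) ∘P P ≡ R → RedexOrigin t R
  ls-abs   : ∀ D C u → t ≡ plug D (es (plug C (var (nb C))) u) →
             IsAbs (relUnf (D ∘C esLC C u) (wk (suc (nb C)) u)) →
             ∀ Q L y → D ∘C esLC C u ≡ Q ∘C appLC (toS L) y → unfCtx Q ≡ R → RedexOrigin t R

data SubstHead : Tm → Set where
  var-head : ∀ L i   → SubstHead (plug (toS L) (var i))
  lam-head : ∀ L s   → SubstHead (plug (toS L) (lam s))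
  app-head : ∀ L x y → SubstHead (plug (toS L) (app x y))

substHead : ∀ t → SubstHead t
substHead (var i)   = var-head shole i
substHead (lam t)   = lam-head shole t
substHead (app t u) = app-head shole t u
substHead (es t u) with substHead t
... | var-head L i   = var-head (ssub L u) i
... | lam-head L s   = lam-head (ssub L u) s
... | app-head L x y = app-head (ssub L u) x y

unfCtx-extend : ∀ E F P → unfCtx (E ∘C F) ∘P P ≡ unfCtx E ∘P (relSubCtx E 0 (unfCtx F) ∘P P)
unfCtx-extend E F P = trans (cong (_∘P P) (unfCtx-∘ E F)) (∘P-assoc (unfCtx E) _ P)

relSub-applied-head : ∀ E L y x → relSub (E ∘C appLC (toS L) y) 0 (unf x) ≡ relSub E 0 (unf (plug (toS L) x))
relSub-applied-head E L y x = begin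
  relSub (E ∘C appLC (toS L) y) 0 (unf x)             ≡⟨ relSub-∘ E (appLC (toS L) y) 0 (unf x) ⟩
  relSub E (nλ (toS L)) (relSub (toS L) 0 (unf x))    ≡⟨ cong (λ n → relSub E n (relSub (toS L) 0 (unf x))) (nλ-toS L) ⟩
  relSub E 0 (relSub (toS L) 0 (unf x))               ≡⟨ cong (relSub E 0) (unf-plug-toS L x) ⟨
  relSub E 0 (unf (plug (toS L) x))                   ∎

pvar≢pplug-redex : ∀ j P a b → pvar j ≢ pplug P (papp (plam a) b)
pvar≢pplug-redex j phole        a b ()
pvar≢pplug-redex j (plamC P)    a b ()
pvar≢pplug-redex j (pappLC P _) a b ()
pvar≢pplug-redex j (pappRC _ P) a b ()

root-redex-origin : ∀ {T a t₁} E t₂ → SubstHead t₁ → T ≡ plug E (app t₁ t₂) →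
  relSub E 0 (unf t₁) ≡ plam a → RedexOrigin T (unfCtx E)
root-redex-origin E t₂ (lam-head L s) eT _ = dB-redex E L s t₂ eT refl
root-redex-origin E t₂ (app-head L x y) _ e
  with () ← trans (sym (trans (cong (relSub E 0) (trans (unf-plug-toS L (app x y)) (relSub-papp (toS L) 0 (unf x) (unf y))))
                              (relSub-papp E 0 _ _))) e
root-redex-origin {T} {a} E t₂ (var-head L i) eT e with var-binder (E ∘C appLC (toS L) t₂) i
... | inj₂ (j , e′ , _) with () ← trans (sym e′) (trans (relSub-applied-head E L t₂ (var i)) e)
... | inj₁ (E₁ , C , u , eE , refl) =
  ls-abs E₁ C u position-of-var
    (a , trans (sym (relSub-ES-bound-var E₁ C u))
               (trans (cong (λ Z → relSub Z 0 (pvar (nb C))) (sym eE)) (trans (relSub-applied-head E L t₂ (var (nb C))) e)))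
    E L t₂ (sym eE) refl
  where
    position-of-var : T ≡ plug E₁ (es (plug C (var (nb C))) u)
    position-of-var = begin
      T                                           ≡⟨ eT ⟩
      plug E (app (plug (toS L) (var (nb C))) t₂) ≡⟨ plug-∘ E (appLC (toS L) t₂) _ ⟨
      plug (E ∘C appLC (toS L) t₂) (var (nb C))   ≡⟨ cong (λ Z → plug Z (var (nb C))) eE ⟩
      plug (E₁ ∘C esLC C u) (var (nb C))          ≡⟨ plug-∘ E₁ (esLC C u) _ ⟩
      plug E₁ (es (plug C (var (nb C))) u)        ∎

β-redex-origin : ∀ t E T → T ≡ plug E t → ∀ P a b →
  relSub E 0 (unf t) ≡ pplug P (papp (plam a) b) → RedexOrigin T (unfCtx E ∘P P)
β-redex-origin (var i) E T eT P a b e with var-binder E i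
... | inj₂ (j , e′ , _) = ⊥-elim (pvar≢pplug-redex j P a b (trans (sym e′) e))
... | inj₁ (E₁ , C , u , refl , refl) =
  ls-redex E₁ C u (trans eT (plug-∘ E₁ (esLC C u) _))
    (P , a , b , trans (sym (relSub-ES-bound-var E₁ C u)) e) P refl
β-redex-origin (lam t) E T eT P a b e with trans (sym (relSub-plam E 0 (unf t))) e
... | e′ with P
...   | plamC P′ =
  subst (RedexOrigin T) position
    (β-redex-origin t (E ∘C lamC hole) T (trans eT (sym (plug-∘ E (lamC hole) t))) P′ a b
      (trans (relSub-∘ E (lamC hole) 0 (unf t)) (plam-injective e′)))
  where
    position : unfCtx (E ∘C lamC hole) ∘P P′ ≡ unfCtx E ∘P plamC P′
    position = trans (unfCtx-extend E (lamC hole) P′)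
                 (cong (λ Z → unfCtx E ∘P (Z ∘P P′)) (trans (relSubCtx-plamC E 0 phole) (cong plamC (relSubCtx-phole E 1))))
...   | phole with () ← e′
...   | pappLC _ _ with () ← e′
...   | pappRC _ _ with () ← e′
β-redex-origin (app t₁ t₂) E T eT P a b e with trans (sym (relSub-papp E 0 (unf t₁) (unf t₂))) e
... | e′ with P
...   | pappLC P′ x =
  subst (RedexOrigin T) position
    (β-redex-origin t₁ (E ∘C appLC hole t₂) T (trans eT (sym (plug-∘ E (appLC hole t₂) t₁))) P′ a b
      (trans (relSub-∘ E (appLC hole t₂) 0 (unf t₁)) (papp-injectiveˡ e′)))
  where
    position : unfCtx (E ∘C appLC hole t₂) ∘P P′ ≡ unfCtx E ∘P pappLC P′ x
    position = trans (unfCtx-extend E (appLC hole t₂) P′)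
                 (cong (λ Z → unfCtx E ∘P (Z ∘P P′))
                   (trans (relSubCtx-pappLC E 0 phole (unf t₂)) (cong₂ pappLC (relSubCtx-phole E 0) (papp-injectiveʳ e′))))
...   | pappRC x P′ =
  subst (RedexOrigin T) position
    (β-redex-origin t₂ (E ∘C appRC t₁ hole) T (trans eT (sym (plug-∘ E (appRC t₁ hole) t₂))) P′ a b
      (trans (relSub-∘ E (appRC t₁ hole) 0 (unf t₂)) (papp-injectiveʳ e′)))
  where
    position : unfCtx (E ∘C appRC t₁ hole) ∘P P′ ≡ unfCtx E ∘P pappRC x P′
    position = trans (unfCtx-extend E (appRC t₁ hole) P′)
                 (cong (λ Z → unfCtx E ∘P (Z ∘P P′))
                   (trans (relSubCtx-pappRC E 0 phole (unf t₁)) (cong₂ pappRC (papp-injectiveˡ e′) (relSubCtx-phole E 0))))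
...   | plamC _ with () ← e′
...   | phole = subst (RedexOrigin T) (sym (∘P-identityʳ (unfCtx E)))
                  (root-redex-origin E t₂ (substHead t₁) eT (papp-injectiveˡ e′))
β-redex-origin (es t u) E T eT P a b e =
  subst (RedexOrigin T) position
    (β-redex-origin t (E ∘C esLC hole u) T (trans eT (sym (plug-∘ E (esLC hole u) t))) P a b
      (trans (relSub-∘ E (esLC hole u) 0 (unf t)) e))
  where
    position : unfCtx (E ∘C esLC hole u) ∘P P ≡ unfCtx E ∘P P
    position = trans (unfCtx-extend E (esLC hole u) P) (cong (λ Z → unfCtx E ∘P (Z ∘P P)) (relSubCtx-phole E 0))

-- Unfolding respects the leftmost-outermost order

≺O⇒extends : ∀ {C D} → C ≺O D → Σ SCtx λ F → D ≡ C ∘C F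
≺O⇒extends (O-hole {C} _) = C , refl
≺O⇒extends (O-ctx E {C} p) with ≺O⇒extends p
... | F , refl = F , sym (∘C-assoc E C F)

≺L⇒fork : ∀ {C D} → C ≺L D → Σ SCtx λ E → Σ SCtx λ C₁ → Σ Tm λ u → Σ Tm λ t → Σ SCtx λ D₁ →
            C ≡ E ∘C appLC C₁ u × D ≡ E ∘C appRC t D₁
≺L⇒fork (L-app {C} {D} {t} {u} _ _) = hole , C , u , t , D , refl , refl
≺L⇒fork (L-ctx E p) with ≺L⇒fork p
... | E₀ , C₁ , u , t , D₁ , refl , refl =
  E ∘C E₀ , C₁ , u , t , D₁ , sym (∘C-assoc E E₀ _) , sym (∘C-assoc E E₀ _)

extends⇒≺LOP : ∀ {C D} G → D ≡ C ∘P G → D ≢ C → C ≺LOP D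
extends⇒≺LOP {C} G refl D≢C =
  inj₁ (subst (_≺OP (C ∘P G)) (∘P-identityʳ C)
    (O-ctx C (O-hole (λ G≡phole → D≢C (trans (cong (C ∘P_) G≡phole) (∘P-identityʳ C))))))

fork⇒≺LOP : ∀ {C D T} E X u t Y → C ≡ E ∘P pappLC X u → D ≡ E ∘P pappRC t Y →
            C ≺pP T → D ≺pP T → C ≺LOP D
fork⇒≺LOP E X u t Y refl refl (Z₁ , e₁) (Z₂ , e₂) =
  inj₂ (L-ctx E (L-app (Z₁ , sym (papp-injectiveˡ same)) (Z₂ , papp-injectiveʳ same)))
  where
    same : papp (pplug X Z₁) u ≡ papp t (pplug Y Z₂)
    same = pplug-injective E (trans (sym (pplug-∘ E (pappLC X u) Z₁))
                               (trans (sym e₁) (trans e₂ (pplug-∘ E (pappRC t Y) Z₂))))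

unfCtx-appLC : ∀ E C u → unfCtx (E ∘C appLC C u) ≡ unfCtx E ∘P pappLC (relSubCtx E 0 (unfCtx C)) (relSub E 0 (unf u))
unfCtx-appLC E C u = trans (unfCtx-∘ E (appLC C u)) (cong (unfCtx E ∘P_) (relSubCtx-pappLC E 0 (unfCtx C) (unf u)))

unfCtx-appRC : ∀ E C t → unfCtx (E ∘C appRC t C) ≡ unfCtx E ∘P pappRC (relSub E 0 (unf t)) (relSubCtx E 0 (unfCtx C))
unfCtx-appRC E C t = trans (unfCtx-∘ E (appRC t C)) (cong (unfCtx E ∘P_) (relSubCtx-pappRC E 0 (unfCtx C) (unf t)))

unfCtx-≺pP : ∀ {t} C x → t ≡ plug C x → unfCtx C ≺pP unf t
unfCtx-≺pP C x refl = relSub C 0 (unf x) , unf-plug C x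

≺LO-unfCtx : ∀ {C D R T} P → C ≺LO D → unfCtx D ∘P P ≡ R →
             unfCtx C ≺pP T → R ≺pP T → R ≢ unfCtx C → unfCtx C ≺LOP R
≺LO-unfCtx {C} P (inj₁ C≺D) refl _ _ R≢C with ≺O⇒extends C≺D
... | F , refl = extends⇒≺LOP (relSubCtx C 0 (unfCtx F) ∘P P) (unfCtx-extend C F P) R≢C
≺LO-unfCtx P (inj₂ C≺D) refl posC posR _ with ≺L⇒fork C≺D
... | E , C₁ , u , t , D₁ , refl , refl =
  fork⇒≺LOP (unfCtx E) _ _ _ (relSubCtx E 0 (unfCtx D₁) ∘P P) (unfCtx-appLC E C₁ u)
    (trans (cong (_∘P P) (unfCtx-appRC E D₁ t)) (∘P-assoc (unfCtx E) _ P)) posC posR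

-- An application can sit neither inside the substitution context of an
-- applied variable nor to the right of its application.
≺LO-applied-var : ∀ {t C Q L y i a b} → t ≡ plug C (app a b) → t ≡ plug (Q ∘C appLC (toS L) y) (var i) →
                  unfCtx Q ≢ unfCtx C → C ≺LO (Q ∘C appLC (toS L) y) → unfCtx C ≺LOP unfCtx Q
≺LO-applied-var {C = C} {Q} {L} {y} tC tQ Q≢C (inj₁ C≺Q) with ≺O⇒extends C≺Q
... | F , eF with ∘C-prefixes-comparable Q (appLC (toS L) y) C F eF
...   | inj₂ (G , refl , _) = extends⇒≺LOP (relSubCtx C 0 (unfCtx G)) (unfCtx-∘ C G) Q≢C
...   | inj₁ (hole , C≡Q , _) = ⊥-elim (Q≢C (cong unfCtx (sym (trans C≡Q (∘C-identityʳ Q)))))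
...   | inj₁ (appLC G y′ , refl , eG) with suffix-of-toS L G F (appLC-injectiveˡ eG) | appLC-injectiveʳ eG
...     | L′ , refl | refl =
  ⊥-elim (plug-toS-var≢app L′ _ _ _ (sym (plug-injective G (trans (app-injectiveˡ (plug-injective Q holes)) inner))))
  where
    inner : plug (toS L) (var _) ≡ plug G (plug (toS L′) (var _))
    inner = trans (cong (λ Z → plug Z (var _)) (appLC-injectiveˡ eG)) (plug-∘ G (toS L′) _)
    holes : plug Q (app (plug G (app _ _)) y) ≡ plug Q (app (plug (toS L) (var _)) y)
    holes = trans (sym (plug-∘ Q (appLC G y) _)) (trans (sym tC) (trans tQ (plug-∘ Q (appLC (toS L) y) _)))
≺LO-applied-var {C = C} {Q} {L} {y} tC tQ _ (inj₂ C≺Q) with ≺L⇒fork C≺Q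
... | E , C₁ , u , t₀ , D₁ , refl , eD with ∘C-prefixes-comparable Q (appLC (toS L) y) E (appRC t₀ D₁) eD
...   | inj₂ (appRC _ G , refl , refl) =
  fork⇒≺LOP (unfCtx E) _ _ _ _ (unfCtx-appLC E C₁ u) (unfCtx-appRC E G t₀)
    (unfCtx-≺pP C _ tC) (unfCtx-≺pP Q _ (trans tQ (plug-∘ Q _ _)))
...   | inj₁ (appLC G _ , _ , eG) with suffix-of-toS L G (appRC t₀ D₁) (appLC-injectiveˡ eG)
...     | L′ , eL′ = ⊥-elim (appRC≢toS L′ t₀ D₁ eL′)

var-app-positions-≢ : ∀ {t C D i a b} → t ≡ plug C (app a b) → t ≡ plug D (var i) → D ≢ C
var-app-positions-≢ {C = C} tC tD refl with () ← plug-injective C (trans (sym tD) tC)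

ls-position : ∀ {t} D C u → t ≡ plug D (es (plug C (var (nb C))) u) → t ≡ plug (D ∘C esLC C u) (var (nb C))
ls-position D C u eq = trans eq (sym (plug-∘ D (esLC C u) _))

LOU-dB-image-is-LO : ∀ {t C L s u R t′} → t ≡ plug C (app (plug (toS L) (lam s)) u) →
  (∀ {D t″} (q : Step t D t″) → Useful q → D ≢ C → C ≺LO D) →
  BetaStep (unf t) R t′ → R ≢ unfCtx C → unfCtx C ≺LOP R
LOU-dB-image-is-LO {t} {C} tC lo (β R a b eβ) R≢C with β-redex-origin t hole t refl R a b eβ
... | dB-redex C′ L′ s′ u′ tC′ img =
  ≺LO-unfCtx phole (lo (dB C′ L′ s′ u′ tC′) tt (λ C′≡C → R≢C (trans (sym img) (cong unfCtx C′≡C))))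
    (trans (∘P-identityʳ _) img) (unfCtx-≺pP C _ tC) (_ , eβ) R≢C
... | ls-redex D C₀ u₀ tD redex P img =
  ≺LO-unfCtx P (lo (ls D C₀ u₀ tD) (inj₁ redex) (var-app-positions-≢ tC (ls-position D C₀ u₀ tD)))
    img (unfCtx-≺pP C _ tC) (_ , eβ) R≢C
... | ls-abs D C₀ u₀ tD abs Q L′ y eQ refl =
  ≺LO-applied-var tC (trans (ls-position D C₀ u₀ tD) (cong (λ Z → plug Z _) eQ)) R≢C
    (subst (C ≺LO_) eQ (lo (ls D C₀ u₀ tD) (inj₂ (abs , Q , L′ , y , eQ))
                          (var-app-positions-≢ tC (ls-position D C₀ u₀ tD))))

LOUStep-image : ∀ {t t′} (r : LOUStep t t′) →
  (unf t ≡ unf t′ × isDB (LOUStep.step r) ≡ 0) ⊎ (LOβStep (unf t) (unf t′) × isDB (LOUStep.step r) ≡ 1)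
LOUStep-image record { step = ls D C u tD } = inj₁ (trans (cong unf tD) (ls-preserves-unf D C u) , refl)
LOUStep-image {t} record { step = dB C L s u tC ; lo = lo } = inj₂ (record
  { pos  = unfCtx C
  ; step = subst (BetaStep (unf t) (unfCtx C)) (sym (unf-dB-contractum C L s u))
                 (β (unfCtx C) (dBBody C L s) (relSub C 0 (unf u)) (trans (cong unf tC) (unf-dB-redex C L s u)))
  ; lo   = LOU-dB-image-is-LO tC lo
  } , refl)

mainTheorem5 : (t u : Tm) (ρ : LOU* t u) →
    Σ (LOβ* (unf t) (unf u)) (λ σ → βlen σ ≡ dBlen ρ)
mainTheorem5 t .t [] = [] , refl
mainTheorem5 t u (r ∷ ρ) with LOUStep-image r | mainTheorem5 _ u ρ
... | inj₁ (same , isDB≡0) | σ , len rewrite same | isDB≡0 = σ , len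
... | inj₂ (step , isDB≡1) | σ , len rewrite isDB≡1 = step ∷ σ , cong suc len
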